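{- For every integer $k\ge0$, the tree $F_k$ has order $\Theta(k^2)$, $\operatorname{bdim}(F_k)=O(k)$, and $\operatorname{adim}(F_k)=\Theta(k^2)$.
   Context: For $k\ge0$, $L_k$ is the path $v_0,v_1,\dots,v_k$, and $F_k$ is the tree obtained from $L_k$ by attaching, for each $1\le i\le k$, a path on $i$ vertices with one endpoint joined by an edge to $v_i$. $d(u,v)$ is graph distance and $d_k(u,v)=\min\{d(u,v),k+1\}$. A function $f:V(G)\to\mathbb{Z}_{\ge0}$ is a resolving broadcast of $G$ if for any distinct $x,y$ there is $z$ with $f(z)>0$ and $d_{f(z)}(x,z)\ne d_{f(z)}(y,z)$; $\operatorname{bdim}(G)$ is the minimum of $\sum_v f(v)$ over resolving broadcasts. A set $A\subseteq V(G)$ is an adjacency resolving set if for any distinct $x,y$ there is $z\in A$ with $d_1(x,z)\ne d_1(y,z)$; $\operatorname{adim}(G)$ is the minimum size of such a set. -}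

module Defs where

open import Data.Nat using (ℕ; zero; suc; _+_; _*_; _≤_; _<_; _≡ᵇ_)
open import Data.Bool using (Bool; true; false; _∧_; _∨_; if_then_else_)
open import Data.Fin using (Fin; toℕ)
open import Data.Fin.Properties using () renaming (_≟_ to _≟ᶠ_)
open import Data.List using (List; length; map; allFin)
open import Data.Nat.ListAction using (sum)
open import Data.List.Membership.Propositional using (_∈_)
open import Data.List.Relation.Unary.Unique.Propositional using (Unique)
open import Data.Product using (Σ; _×_; _,_; ∃-syntax)
open import Relation.Binary.PropositionalEquality using (_≡_; _≢_)
open import Relation.Nullary.Decidable using (⌊_⌋)

record Graph : Set where
  field
    n   : ℕ
    adj : Fin n → Fin n → Bool
open Graph public

order : Graph → ℕ
order G = n G

anyFin : (m : ℕ) → (Fin m → Bool) → Bool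
anyFin zero    p = false
anyFin (suc m) p = p Fin.zero ∨ anyFin m (λ i → p (Fin.suc i))

-- within G m x y  =  true iff d(x,y) ≤ m  (there is a walk of length ≤ m)
within : (G : Graph) → ℕ → Fin (n G) → Fin (n G) → Bool
within G zero    x y = ⌊ x ≟ᶠ y ⌋
within G (suc m) x y =
  within G m x y ∨ anyFin (n G) (λ w → within G m x w ∧ adj G w y)

-- truncated distance  d_t(x,y) = min { d(x,y) , t + 1 }
dt : (G : Graph) → ℕ → Fin (n G) → Fin (n G) → ℕ
dt G zero    x y = if within G zero x y then 0 else 1
dt G (suc t) x y = if within G (suc t) x y then dt G t x y else suc (suc t)

IsResolvingBroadcast : (G : Graph) → (Fin (n G) → ℕ) → Set
IsResolvingBroadcast G f =
  (x y : Fin (n G)) → x ≢ y →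
    ∃[ z ] (0 < f z × dt G (f z) x z ≢ dt G (f z) y z)

cost : (G : Graph) → (Fin (n G) → ℕ) → ℕ
cost G f = sum (map f (allFin (n G)))

IsAdjResolving : (G : Graph) → List (Fin (n G)) → Set
IsAdjResolving G A =
  (x y : Fin (n G)) → x ≢ y →
    ∃[ z ] (z ∈ A × dt G 1 x z ≢ dt G 1 y z)

-- bdim G ≤ m  (bdim is a minimum, so this unfolds to existence of a witness)
BdimAtMost : Graph → ℕ → Set
BdimAtMost G m = ∃[ f ] (IsResolvingBroadcast G f × cost G f ≤ m)

AdimAtMost : Graph → ℕ → Set
AdimAtMost G m =
  ∃[ A ] (Unique A × IsAdjResolving G A × length A ≤ m)

AdimScaledAtLeast : Graph → ℕ → ℕ → Set
AdimScaledAtLeast G c m =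
  (A : List (Fin (n G))) → Unique A → IsAdjResolving G A → m ≤ c * length A

-- Vertices are pairs (i , j) with 0 ≤ j ≤ i ≤ k:
--   (i , 0) is the spine vertex v_i,
--   (i , j) for 1 ≤ j ≤ i is the j-th vertex of the pendant path at v_i
--   ((i , 1) is the endpoint joined to v_i).
-- They are numbered 0,1,2,... in the order
--   (0,0),(1,0),(1,1),(2,0),(2,1),(2,2),(3,0),...

tri : ℕ → ℕ
tri zero    = 0
tri (suc m) = tri m + suc m

decode : ℕ → ℕ × ℕ
decode zero = 0 , 0
decode (suc m) with decode m
... | i , j = if j ≡ᵇ i then (suc i , 0) else (i , suc j)

adjPair : ℕ × ℕ → ℕ × ℕ → Bool
adjPair (i , j) (i' , j') =
  ((j ≡ᵇ 0) ∧ (j' ≡ᵇ 0) ∧ ((i' ≡ᵇ suc i) ∨ (i ≡ᵇ suc i')))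
  ∨ ((i ≡ᵇ i') ∧ ((j' ≡ᵇ suc j) ∨ (j ≡ᵇ suc j')))

F : ℕ → Graph
F k = record
  { n   = tri (suc k)
  ; adj = λ a b → adjPair (decode (toℕ a)) (decode (toℕ b))
  }

module Submission where

-- Order.  F_k has 1 + 2 + ... + (k+1) = (k+1)(k+2)/2 vertices.
--
-- In an arbitrary graph, a potential ψ that vanishes
-- only at z, is 1-Lipschitz along edges and can always be decreased by one
-- along an edge is the distance to z, and a broadcast from z of strength at
-- least max ψ reads ψ off exactly.  Giving the vertices of F_k coordinates
-- (i , j), 0 ≤ j ≤ i ≤ k (j = depth in the pendant path at v_i), the
-- distance to the spine vertex v_r is |i - r| + j.  The distances to v_0
-- and v_k determine (i , j), so broadcasting 2k from v_0 and k from v_k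
-- resolves F_k at cost 3k.
--
-- The whole vertex set is always adjacency resolving.
-- Conversely, if the closed neighbourhoods of a graph can be labelled
-- injectively with b labels, an adjacency resolving set A forces
-- n ≤ 1 + b·|A|; in F_k the relative position of a vertex to an
-- adjacent-or-equal one takes five values, so k² ≤ 10·|A|.

open import Defs
open import Data.Nat using (ℕ; _*_; _≤_)
open import Data.Product using (_×_; ∃-syntax)

open import Data.Bool using (Bool; true; false; T; _∧_; _∨_; if_then_else_)
open import Data.Bool.Properties using (T-∨; T-∧; T-≡; ¬-not)
open import Data.Fin using (Fin; zero; suc; toℕ; fromℕ<)
open import Data.Fin.Properties
  using (toℕ-fromℕ<; toℕ-injective; toℕ<n; injective⇒≤) renaming (_≟_ to _≟ᶠ_)
open import Data.List using (List; []; _∷_; length; tabulate; allFin)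
open import Data.List.Properties using (map-tabulate; length-tabulate)
open import Data.List.Membership.Propositional using (_∈_)
open import Data.List.Membership.Propositional.Properties using (∈-allFin)
open import Data.List.Relation.Unary.Any using (here; there)
open import Data.List.Relation.Unary.Unique.Propositional.Properties using (allFin⁺)
open import Data.Nat
  using (zero; suc; pred; _+_; _∸_; _<_; _≡ᵇ_; ∣_-_∣; z≤n; s≤s; _≤′_; ≤′-reflexive; ≤′-step)
open import Data.Nat.ListAction using (sum)
open import Data.Nat.Properties
open import Data.Nat.Tactic.RingSolver using (solve-∀)
open import Data.Product using (_,_; proj₁; proj₂)
open import Data.Sum using (_⊎_; inj₁; inj₂)
open import Function using (_∘_; id)
open import Function.Bundles using (Equivalence)
open import Relation.Binary.PropositionalEquality
  using (_≡_; _≢_; ≢-sym; refl; sym; trans; cong; cong₂; subst; module ≡-Reasoning)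
open import Relation.Nullary using (¬_; Dec; yes; no; contradiction)
open import Relation.Nullary.Decidable using (toWitness; fromWitness; T?; map′)

∨-introˡ : ∀ {a} b → T a → T (a ∨ b)
∨-introˡ b = Equivalence.from T-∨ ∘ inj₁

∨-introʳ : ∀ a {b} → T b → T (a ∨ b)
∨-introʳ a = Equivalence.from T-∨ ∘ inj₂

if-T : ∀ {A : Set} b {u v : A} → T b → (if b then u else v) ≡ u
if-T true _ = refl

if-¬T : ∀ {A : Set} b {u v : A} → ¬ T b → (if b then u else v) ≡ v
if-¬T true  ¬t = contradiction _ ¬t
if-¬T false _  = refl

≡ᵇ-refl : ∀ n → (n ≡ᵇ n) ≡ true
≡ᵇ-refl n = Equivalence.to T-≡ (≡⇒≡ᵇ n n refl)

≢⇒≡ᵇ-false : ∀ {m n} → m ≢ n → (m ≡ᵇ n) ≡ false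
≢⇒≡ᵇ-false {m} {n} m≢n = ¬-not (m≢n ∘ ≡ᵇ⇒≡ m n ∘ Equivalence.from T-≡)

≡ᵇ-true⇒≡ : ∀ m n → (m ≡ᵇ n) ≡ true → m ≡ n
≡ᵇ-true⇒≡ m n = ≡ᵇ⇒≡ m n ∘ Equivalence.from T-≡

≡ᵇ-false⇒≢ : ∀ m n → (m ≡ᵇ n) ≡ false → m ≢ n
≡ᵇ-false⇒≢ m n e m≡n = subst T e (≡⇒≡ᵇ m n m≡n)

anyFin-witness : ∀ m (p : Fin m → Bool) → T (anyFin m p) → ∃[ w ] T (p w)
anyFin-witness (suc m) p t with Equivalence.to T-∨ t
... | inj₁ t₀ = zero , t₀
... | inj₂ t₁ with anyFin-witness m (p ∘ suc) t₁
...   | w , t = suc w , t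

anyFin-intro : ∀ m (p : Fin m → Bool) w → T (p w) → T (anyFin m p)
anyFin-intro (suc m) p zero    t = ∨-introˡ _ t
anyFin-intro (suc m) p (suc w) t = ∨-introʳ (p zero) (anyFin-intro m (p ∘ suc) w t)

point : ∀ {m} → ℕ → ℕ → Fin m → ℕ
point p c v = if toℕ v ≡ᵇ p then c else 0

point-at : ∀ {m} p c (v : Fin m) → toℕ v ≡ p → point p c v ≡ c
point-at p c v refl = if-T (toℕ v ≡ᵇ toℕ v) (≡⇒≡ᵇ (toℕ v) _ refl)

sum-zeros : ∀ m → sum (tabulate {n = m} (λ _ → 0)) ≡ 0
sum-zeros zero    = refl
sum-zeros (suc m) = sum-zeros m

sum-point : ∀ m p c → sum (tabulate {n = m} (point p c)) ≤ c
sum-point zero    p       c = z≤n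
sum-point (suc m) zero    c = ≤-reflexive (trans (cong (c +_) (sum-zeros m)) (+-identityʳ c))
sum-point (suc m) (suc p) c = sum-point m p c

sum-+ : ∀ m (f g : Fin m → ℕ) →
  sum (tabulate (λ v → f v + g v)) ≡ sum (tabulate f) + sum (tabulate g)
sum-+ zero    f g = refl
sum-+ (suc m) f g = begin
  f zero + g zero + sum (tabulate (λ v → f (suc v) + g (suc v)))
    ≡⟨ cong (f zero + g zero +_) (sum-+ m (f ∘ suc) (g ∘ suc)) ⟩
  f zero + g zero + (sum (tabulate (f ∘ suc)) + sum (tabulate (g ∘ suc)))
    ≡⟨ +-interchange (f zero) (g zero) _ _ ⟩
  f zero + sum (tabulate (f ∘ suc)) + (g zero + sum (tabulate (g ∘ suc))) ∎
  where
  open ≡-Reasoning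
  +-interchange : ∀ a b c d → a + b + (c + d) ≡ a + c + (b + d)
  +-interchange = solve-∀

cost-two-points : ∀ G p q c d → cost G (λ v → point p c v + point q d v) ≤ c + d
cost-two-points G p q c d = begin
  cost G (λ v → f v + g v)                 ≡⟨ cong sum (map-tabulate id (λ v → f v + g v)) ⟩
  sum (tabulate (λ v → f v + g v))         ≡⟨ sum-+ (n G) f g ⟩
  sum (tabulate f) + sum (tabulate g)      ≤⟨ +-mono-≤ (sum-point (n G) p c) (sum-point (n G) q d) ⟩
  c + d                                    ∎
  where
  open ≤-Reasoning
  f g : Fin (n G) → ℕ
  f = point p c
  g = point q d

module _ (G : Graph) where

  Vertex : Set
  Vertex = Fin (n G)

  record Reach (m : ℕ) (x y : Vertex) : Set where
    constructor reach
    field reached : T (within G m x y)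

  record Edge (x y : Vertex) : Set where
    constructor edge
    field joined : T (adj G x y)

  open Reach
  open Edge

  reach? : ∀ m x y → Dec (Reach m x y)
  reach? m x y = map′ reach reached (T? (within G m x y))

  reach-refl : ∀ x → Reach 0 x x
  reach-refl x = reach (fromWitness {a? = x ≟ᶠ x} refl)

  reach0⇒≡ : ∀ {x y} → Reach 0 x y → x ≡ y
  reach0⇒≡ {x} {y} r = toWitness {a? = x ≟ᶠ y} (reached r)

  reach-suc : ∀ {m x y} → Reach m x y → Reach (suc m) x y
  reach-suc r = reach (∨-introˡ _ (reached r))

  reach-mono : ∀ {m m' x y} → m ≤ m' → Reach m x y → Reach m' x y
  reach-mono {x = x} {y} m≤m' = weaken (≤⇒≤′ m≤m')
    where
    weaken : ∀ {m m'} → m ≤′ m' → Reach m x y → Reach m' x y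
    weaken (≤′-reflexive refl) r = r
    weaken (≤′-step m≤′m')     r = reach-suc (weaken m≤′m' r)

  reach-last-edge : ∀ {m x y} → Reach (suc m) x y →
    Reach m x y ⊎ ∃[ w ] (Reach m x w × Edge w y)
  reach-last-edge r with Equivalence.to T-∨ (reached r)
  ... | inj₁ t = inj₁ (reach t)
  ... | inj₂ t with anyFin-witness _ _ t
  ...   | w , t' with Equivalence.to T-∧ t'
  ...     | t₁ , t₂ = inj₂ (w , reach t₁ , edge t₂)

  reach-snoc : ∀ {m x w y} → Reach m x w → Edge w y → Reach (suc m) x y
  reach-snoc {w = w} r e =
    reach (∨-introʳ _ (anyFin-intro _ _ w (Equivalence.from T-∧ (reached r , joined e))))

  reach-cons : ∀ m {x' x y} → Edge x' x → Reach m x y → Reach (suc m) x' y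
  reach-cons zero {x'} e r with reach0⇒≡ r
  ... | refl = reach-snoc (reach-refl x') e
  reach-cons (suc m) e r with reach-last-edge r
  ... | inj₁ r' = reach-suc (reach-cons m e r')
  ... | inj₂ (w , r' , e') = reach-snoc (reach-cons m e r') e'

  reach1⇒closed-neighbour : ∀ {x y} → Reach 1 x y → x ≡ y ⊎ Edge x y
  reach1⇒closed-neighbour r with reach-last-edge r
  ... | inj₁ r₀ = inj₁ (reach0⇒≡ r₀)
  ... | inj₂ (w , r₀ , e) with reach0⇒≡ r₀
  ...   | refl = inj₂ e

  dt-far : ∀ t {x y} → ¬ Reach t x y → dt G t x y ≡ suc t
  dt-far zero    ¬r = if-¬T _ (¬r ∘ reach)
  dt-far (suc t) ¬r = if-¬T _ (¬r ∘ reach)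

  dt-exact : ∀ t {x y} d → d ≤ t → Reach d x y → (∀ e → Reach e x y → d ≤ e) →
    dt G t x y ≡ d
  dt-exact zero    .zero z≤n r _ = if-T _ (reached r)
  dt-exact (suc t) d d≤1+t r minimal with d ≤? t
  ... | yes d≤t = trans (if-T _ (reached (reach-mono d≤1+t r))) (dt-exact t d d≤t r minimal)
  ... | no  d≰t = trans (if-T _ (reached (reach-mono d≤1+t r)))
                    (trans (dt-far t (d≰t ∘ minimal t)) (≤-antisym (≰⇒> d≰t) d≤1+t))

  dt-self : ∀ t x → dt G t x x ≡ 0
  dt-self t x = dt-exact t 0 z≤n (reach-refl x) (λ _ _ → z≤n)

  dt≡0⇒≡ : ∀ t {x y} → dt G t x y ≡ 0 → x ≡ y
  dt≡0⇒≡ t {x} {y} dt≡0 with reach? t x y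
  ... | no ¬r = contradiction (trans (sym (dt-far t ¬r)) dt≡0) λ ()
  dt≡0⇒≡ zero    dt≡0 | yes r = reach0⇒≡ r
  dt≡0⇒≡ (suc t) dt≡0 | yes r = dt≡0⇒≡ t (trans (sym (if-T _ (reached r))) dt≡0)

  record DistanceFunction (z : Vertex) : Set where
    field
      ψ         : Vertex → ℕ
      ψ-root    : ψ z ≡ 0
      ψ⁻¹-root  : ∀ {x} → ψ x ≡ 0 → x ≡ z
      lipschitz : ∀ {w y} → Edge w y → ψ w ≤ suc (ψ y)
      descent   : ∀ {x m} → ψ x ≡ suc m → ∃[ x' ] (Edge x x' × ψ x' ≡ m)

  module _ {z} (D : DistanceFunction z) where
    open DistanceFunction D

    ψ-lower : ∀ m {x y} → Reach m x y → ψ x ≤ m + ψ y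
    ψ-lower zero r with reach0⇒≡ r
    ... | refl = ≤-refl
    ψ-lower (suc m) r with reach-last-edge r
    ... | inj₁ r' = m≤n⇒m≤1+n (ψ-lower m r')
    ... | inj₂ (w , r' , e) =
      ≤-trans (ψ-lower m r') (≤-trans (+-monoʳ-≤ m (lipschitz e)) (≤-reflexive (+-suc m _)))

    ψ-reach : ∀ m {x} → ψ x ≡ m → Reach m x z
    ψ-reach zero ψx≡0 with ψ⁻¹-root ψx≡0
    ... | refl = reach-refl z
    ψ-reach (suc m) ψx≡1+m with descent ψx≡1+m
    ... | x' , e , ψx'≡m = reach-cons m e (ψ-reach m ψx'≡m)

    dt-potential : ∀ t {x} → ψ x ≤ t → dt G t x z ≡ ψ x
    dt-potential t {x} ψx≤t = dt-exact t (ψ x) ψx≤t (ψ-reach (ψ x) refl) minimal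
      where
      minimal : ∀ e → Reach e x z → ψ x ≤ e
      minimal e r = subst (ψ x ≤_) (trans (cong (e +_) ψ-root) (+-identityʳ e)) (ψ-lower e r)

    landmark-separates : ∀ {t x y} → ψ x ≤ t → ψ y ≤ t → ψ x ≢ ψ y →
      dt G t x z ≢ dt G t y z
    landmark-separates ψx≤t ψy≤t ψx≢ψy e =
      ψx≢ψy (trans (sym (dt-potential _ ψx≤t)) (trans e (dt-potential _ ψy≤t)))

  open DistanceFunction

  two-landmarks-resolve : ∀ {z₁ z₂} (D₁ : DistanceFunction z₁) (D₂ : DistanceFunction z₂)
    (f : Vertex → ℕ) → 0 < f z₁ → 0 < f z₂ →
    (∀ x → ψ D₁ x ≤ f z₁) → (∀ x → ψ D₂ x ≤ f z₂) →
    (∀ {x y} → ψ D₁ x ≡ ψ D₁ y → ψ D₂ x ≡ ψ D₂ y → x ≡ y) →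
    IsResolvingBroadcast G f
  two-landmarks-resolve {z₁} {z₂} D₁ D₂ f pos₁ pos₂ ecc₁ ecc₂ determine x y x≢y
    with ψ D₁ x ≟ ψ D₁ y
  ... | no ≢₁ = z₁ , pos₁ , landmark-separates D₁ (ecc₁ x) (ecc₁ y) ≢₁
  ... | yes ≡₁ with ψ D₂ x ≟ ψ D₂ y
  ...   | no ≢₂ = z₂ , pos₂ , landmark-separates D₂ (ecc₂ x) (ecc₂ y) ≢₂
  ...   | yes ≡₂ = contradiction (determine ≡₁ ≡₂) x≢y

  -- Every vertex set resolves itself: x is the only vertex at distance 0 from x.
  adim-all-vertices : AdimAtMost G (n G)
  adim-all-vertices = allFin _ , allFin⁺ _ , resolves , ≤-reflexive (length-tabulate id)
    where
    resolves : IsAdjResolving G (allFin _)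
    resolves x y x≢y =
      x , ∈-allFin x , λ e → x≢y (sym (dt≡0⇒≡ 1 (trans (sym e) (dt-self 1 x))))

  record NeighbourhoodCode (b : ℕ) : Set where
    field
      label           : Vertex → Vertex → ℕ
      label<b         : ∀ x z → label x z < b
      label-injective : ∀ {x y z} → Reach 1 x z → Reach 1 y z →
                        label x z ≡ label y z → x ≡ y

  module _ {b} (L : NeighbourhoodCode b) where
    open NeighbourhoodCode L

    signature : List Vertex → Vertex → ℕ
    signature []      x = 0
    signature (z ∷ A) x = if within G 1 x z then label x z else b + signature A x

    signature-bound : ∀ A x → signature A x ≤ b * length A
    signature-bound []      x = z≤n
    signature-bound (z ∷ A) x with reach? 1 x z
    ... | yes r = ≤-trans (≤-reflexive (if-T _ (reached r)))
                    (≤-trans (<⇒≤ (label<b x z))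
                      (≤-trans (m≤m+n b _) (≤-reflexive (sym (*-suc b (length A))))))
    ... | no ¬r = ≤-trans (≤-reflexive (if-¬T _ (¬r ∘ reach)))
                    (≤-trans (+-monoʳ-≤ b (signature-bound A x))
                      (≤-reflexive (sym (*-suc b (length A)))))

    label≢shifted : ∀ x z m → label x z ≢ b + m
    label≢shifted x z m = <⇒≢ (<-≤-trans (label<b x z) (m≤m+n b m))

    Far : Vertex → List Vertex → Set
    Far x A = ∀ {z} → z ∈ A → ¬ Reach 1 x z

    signature-injective : ∀ A {x y} → signature A x ≡ signature A y →
      x ≡ y ⊎ (Far x A × Far y A)
    signature-injective []      _ = inj₂ ((λ ()) , (λ ()))
    signature-injective (z ∷ A) {x} {y} eq
      with reach? 1 x z | reach? 1 y z
    ... | yes rx | yes ry = inj₁ (label-injective rx ry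
          (trans (sym (if-T _ (reached rx))) (trans eq (if-T _ (reached ry)))))
    ... | yes rx | no ¬ry = contradiction
          (trans (sym (if-T _ (reached rx))) (trans eq (if-¬T _ (¬ry ∘ reach))))
          (label≢shifted x z _)
    ... | no ¬rx | yes ry = contradiction
          (trans (sym (if-T _ (reached ry))) (trans (sym eq) (if-¬T _ (¬rx ∘ reach))))
          (label≢shifted y z _)
    ... | no ¬rx | no ¬ry
      with signature-injective A (+-cancelˡ-≡ b _ _
             (trans (sym (if-¬T _ (¬rx ∘ reach))) (trans eq (if-¬T _ (¬ry ∘ reach)))))
    ...   | inj₁ x≡y = inj₁ x≡y
    ...   | inj₂ (far-x , far-y) = inj₂ (extend ¬rx far-x , extend ¬ry far-y)
      where
      extend : ∀ {v} → ¬ Reach 1 v z → Far v A → Far v (z ∷ A)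
      extend ¬r far (here refl) = ¬r
      extend ¬r far (there z∈A) = far z∈A

    -- Counting: signatures are injective and take at most 1 + b·|A| values.
    adim-lower : ∀ A → IsAdjResolving G A → n G ≤ suc (b * length A)
    adim-lower A resolving = injective⇒≤ code-injective
      where
      code : Vertex → Fin (suc (b * length A))
      code x = fromℕ< (s≤s (signature-bound A x))

      signature-separates : ∀ {x y} → signature A x ≡ signature A y → x ≡ y
      signature-separates {x} {y} eq with x ≟ᶠ y
      ... | yes x≡y = x≡y
      ... | no x≢y with resolving x y x≢y | signature-injective A eq
      ...   | _ , _ , _ | inj₁ x≡y = x≡y
      ...   | z , z∈A , dt≢ | inj₂ (far-x , far-y) =
        contradiction (trans (dt-far 1 (far-x z∈A)) (sym (dt-far 1 (far-y z∈A)))) dt≢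

      code-injective : ∀ {x y} → code x ≡ code y → x ≡ y
      code-injective eq = signature-separates
        (trans (sym (toℕ-fromℕ< _)) (trans (cong toℕ eq) (toℕ-fromℕ< _)))

-- Coordinates on F_k: vertex number tri i + j is the pair (i , j).

enc : ℕ × ℕ → ℕ
enc (i , j) = tri i + j

Valid : ℕ → ℕ × ℕ → Set
Valid k (i , j) = j ≤ i × i ≤ k

decode-spec : ∀ m → proj₂ (decode m) ≤ proj₁ (decode m) × enc (decode m) ≡ m
decode-spec zero = z≤n , refl
decode-spec (suc m) with decode m | decode-spec m
... | i , j | j≤i , enc≡m with j ≡ᵇ i in e
... | false = ≤∧≢⇒< j≤i (≡ᵇ-false⇒≢ j i e) , trans (+-suc (tri i) j) (cong suc enc≡m)
... | true with ≡ᵇ-true⇒≡ j i e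
...   | refl = z≤n , trans (+-identityʳ (tri j + suc j)) (trans (+-suc (tri j) j) (cong suc enc≡m))

mutual
  decode-spine : ∀ i → decode (tri i) ≡ (i , 0)
  decode-spine zero = refl
  decode-spine (suc i)
    rewrite +-suc (tri i) i | decode-enc i i ≤-refl | ≡ᵇ-refl i = refl

  decode-enc : ∀ i j → j ≤ i → decode (tri i + j) ≡ (i , j)
  decode-enc i zero    _   rewrite +-identityʳ (tri i) = decode-spine i
  decode-enc i (suc j) j<i rewrite +-suc (tri i) j | decode-enc i j (<⇒≤ j<i)
    | ≢⇒≡ᵇ-false (<⇒≢ j<i) = refl

tri-mono : ∀ {a b} → a ≤ b → tri a ≤ tri b
tri-mono {zero}              _         = z≤n
tri-mono {suc a} {suc b} (s≤s a≤b) = +-mono-≤ (tri-mono a≤b) (s≤s a≤b)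

enc-bound : ∀ {k} p → Valid k p → enc p < tri (suc k)
enc-bound (i , j) (j≤i , i≤k) =
  ≤-trans (s≤s (+-monoʳ-≤ (tri i) j≤i))
    (≤-trans (≤-reflexive (sym (+-suc (tri i) i))) (tri-mono (s≤s i≤k)))

enc-bound⇒≤ : ∀ {k i j} → tri i + j < tri (suc k) → i ≤ k
enc-bound⇒≤ {i = i} {j} lt = ≮⇒≥ (λ k<i → <⇒≱ lt (≤-trans (tri-mono k<i) (m≤m+n (tri i) j)))

data Adj : ℕ × ℕ → ℕ × ℕ → Set where
  spine-up   : ∀ i   → Adj (i , 0) (suc i , 0)
  spine-down : ∀ i   → Adj (suc i , 0) (i , 0)
  path-out   : ∀ i j → Adj (i , j) (i , suc j)
  path-in    : ∀ i j → Adj (i , suc j) (i , j)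

≡ᵇ-cases : ∀ a b c d → T ((a ≡ᵇ b) ∨ (c ≡ᵇ d)) → a ≡ b ⊎ c ≡ d
≡ᵇ-cases a b c d t with Equivalence.to (T-∨ {a ≡ᵇ b}) t
... | inj₁ e = inj₁ (≡ᵇ⇒≡ a b e)
... | inj₂ e = inj₂ (≡ᵇ⇒≡ c d e)

adjPair⇒Adj : ∀ p q → T (adjPair p q) → Adj p q
adjPair⇒Adj (i , j) (i' , j') t with Equivalence.to T-∨ t
... | inj₁ spine with Equivalence.to T-∧ spine
...   | j≡0 , t₁ with Equivalence.to T-∧ t₁
...     | j'≡0 , t₂ with ≡ᵇ⇒≡ j 0 j≡0 | ≡ᵇ⇒≡ j' 0 j'≡0 | ≡ᵇ-cases i' (suc i) i (suc i') t₂
...       | refl | refl | inj₁ refl = spine-up i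
...       | refl | refl | inj₂ refl = spine-down i'
adjPair⇒Adj (i , j) (i' , j') t | inj₂ path with Equivalence.to T-∧ path
...   | i≡i' , t₁ with ≡ᵇ⇒≡ i i' i≡i' | ≡ᵇ-cases j' (suc j) j (suc j') t₁
...     | refl | inj₁ refl = path-out i j
...     | refl | inj₂ refl = path-in i j'

Adj⇒adjPair : ∀ {p q} → Adj p q → T (adjPair p q)
Adj⇒adjPair (spine-up i)   = ∨-introˡ _ (∨-introˡ _ (≡⇒≡ᵇ i i refl))
Adj⇒adjPair (spine-down i) = ∨-introˡ _ (∨-introʳ (i ≡ᵇ suc (suc i)) (≡⇒≡ᵇ i i refl))
Adj⇒adjPair (path-out i j) =
  ∨-introʳ _ (Equivalence.from T-∧ (≡⇒≡ᵇ i i refl , ∨-introˡ _ (≡⇒≡ᵇ j j refl)))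
Adj⇒adjPair (path-in i j)  =
  ∨-introʳ _ (Equivalence.from T-∧ (≡⇒≡ᵇ i i refl , ∨-introʳ (j ≡ᵇ suc (suc j)) (≡⇒≡ᵇ j j refl)))

-- height r p: the distance from p to the spine vertex v_r.

height : ℕ → ℕ × ℕ → ℕ
height r (i , j) = ∣ i - r ∣ + j

∣-∣-lipschitz : ∀ a b r → ∣ a - b ∣ ≡ 1 → ∣ a - r ∣ ≤ suc ∣ b - r ∣
∣-∣-lipschitz a b r ∣a-b∣≡1 =
  ≤-trans (∣-∣-triangle a b r) (≤-reflexive (cong (_+ ∣ b - r ∣) ∣a-b∣≡1))

∣i-1+i∣≡1 : ∀ i → ∣ i - suc i ∣ ≡ 1
∣i-1+i∣≡1 i = trans (cong ∣ i -_∣ (+-comm 1 i)) (∣m-m+n∣≡n i 1)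

height-lipschitz : ∀ r {p q} → Adj p q → height r p ≤ suc (height r q)
height-lipschitz r (spine-up i)   = +-monoˡ-≤ 0 (∣-∣-lipschitz i (suc i) r (∣i-1+i∣≡1 i))
height-lipschitz r (spine-down i) =
  +-monoˡ-≤ 0 (∣-∣-lipschitz (suc i) i r (trans (∣-∣-comm (suc i) i) (∣i-1+i∣≡1 i)))
height-lipschitz r (path-out i j) = ≤-trans (+-monoʳ-≤ ∣ i - r ∣ (n≤1+n j)) (n≤1+n _)
height-lipschitz r (path-in i j)  = ≤-reflexive (+-suc ∣ i - r ∣ j)

height-root : ∀ r {p} → height r p ≡ 0 → p ≡ (r , 0)
height-root r {i , j} h≡0 with ∣m-n∣≡0⇒m≡n {i} {r} (m+n≡0⇒m≡0 ∣ i - r ∣ h≡0) | m+n≡0⇒n≡0 ∣ i - r ∣ h≡0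
... | refl | refl = refl

spine-descent : ∀ i r m → ∣ i - r ∣ ≡ suc m →
  (i < r × ∣ suc i - r ∣ ≡ m) ⊎ ∃[ i' ] (i ≡ suc i' × ∣ i' - r ∣ ≡ m)
spine-descent zero    (suc r) m e = inj₁ (s≤s z≤n , suc-injective e)
spine-descent (suc i) zero    m e = inj₂ (i , refl , trans (∣-∣-identityʳ i) (suc-injective e))
spine-descent (suc i) (suc r) m e with spine-descent i r m e
... | inj₁ (i<r , e')           = inj₁ (s≤s i<r , e')
... | inj₂ (i' , refl , e')     = inj₂ (suc i' , refl , e')

height-descent : ∀ {k r} → r ≤ k → ∀ p {m} → Valid k p → height r p ≡ suc m →
  ∃[ q ] (Adj p q × Valid k q × height r q ≡ m)
height-descent r≤k (i , suc j) (j<i , i≤k) h =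
  (i , j) , path-in i j , (<⇒≤ j<i , i≤k) , suc-injective (trans (sym (+-suc _ j)) h)
height-descent {r = r} r≤k (i , zero) {m} (_ , i≤k) h
  with spine-descent i r m (trans (sym (+-identityʳ _)) h)
... | inj₁ (i<r , e) =
  (suc i , 0) , spine-up i , (z≤n , ≤-trans i<r r≤k) , trans (+-identityʳ _) e
... | inj₂ (i' , refl , e) =
  (i' , 0) , spine-down i' , (z≤n , <⇒≤ i≤k) , trans (+-identityʳ _) e

-- The distances to v_0 and to v_k add up to k + 2j, so together they
-- determine the vertex.
height-sum : ∀ {k i} j → i ≤ k → height 0 (i , j) + height k (i , j) ≡ k + 2 * j
height-sum {k} {i} j i≤k = begin
  ∣ i - 0 ∣ + j + (∣ i - k ∣ + j)
    ≡⟨ cong₂ (λ a b → a + j + (b + j)) (∣-∣-identityʳ i) (m≤n⇒∣m-n∣≡n∸m i≤k) ⟩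
  i + j + (k ∸ i + j)
    ≡⟨ regroup i (k ∸ i) j ⟩
  i + (k ∸ i) + 2 * j
    ≡⟨ cong (_+ 2 * j) (m+[n∸m]≡n i≤k) ⟩
  k + 2 * j ∎
  where
  open ≡-Reasoning
  regroup : ∀ a b c → a + c + (b + c) ≡ a + b + 2 * c
  regroup = solve-∀

heights-determine : ∀ {k p q} → Valid k p → Valid k q →
  height 0 p ≡ height 0 q → height k p ≡ height k q → p ≡ q
heights-determine {k} {i , j} {i' , j'} (_ , i≤k) (_ , i'≤k) e₀ eₖ
  with *-cancelˡ-≡ j j' 2 (+-cancelˡ-≡ k _ _
         (trans (sym (height-sum j i≤k)) (trans (cong₂ _+_ e₀ eₖ) (height-sum j' i'≤k))))
... | refl = cong (_, j) (trans (sym (∣-∣-identityʳ i))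
                           (trans (+-cancelʳ-≡ j _ _ e₀) (∣-∣-identityʳ i')))

relPos : ℕ × ℕ → ℕ × ℕ → ℕ
relPos (i , j) (c , d) =
  if i ≡ᵇ c then (if j ≡ᵇ d then 0 else if j ≡ᵇ suc d then 1 else 2)
  else (if i ≡ᵇ suc c then 3 else 4)

move : ℕ → ℕ × ℕ → ℕ × ℕ
move 0 (c , d) = c , d
move 1 (c , d) = c , suc d
move 2 (c , d) = c , pred d
move 3 (c , d) = suc c , 0
move _ (c , d) = pred c , 0

relPos<5 : ∀ p q → relPos p q < 5
relPos<5 (i , j) (c , d) with i ≡ᵇ c | j ≡ᵇ d | j ≡ᵇ suc d | i ≡ᵇ suc c
... | true  | true  | _     | _     = s≤s z≤n
... | true  | false | true  | _     = s≤s (s≤s z≤n)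
... | true  | false | false | _     = s≤s (s≤s (s≤s z≤n))
... | false | _     | _     | true  = s≤s (s≤s (s≤s (s≤s z≤n)))
... | false | _     | _     | false = ≤-refl

move-relPos-self : ∀ p → move (relPos p p) p ≡ p
move-relPos-self (i , j) rewrite ≡ᵇ-refl i | ≡ᵇ-refl j = refl

n≢1+n : ∀ n → n ≢ suc n
n≢1+n n = <⇒≢ (n<1+n n)

n≢2+n : ∀ n → n ≢ suc (suc n)
n≢2+n n = <⇒≢ (m<n⇒m<1+n (n<1+n n))

move-relPos : ∀ {p q} → Adj p q → move (relPos p q) q ≡ p
move-relPos (spine-up i)
  rewrite ≢⇒≡ᵇ-false (n≢1+n i) | ≢⇒≡ᵇ-false (n≢2+n i) = refl
move-relPos (spine-down i)
  rewrite ≢⇒≡ᵇ-false (≢-sym (n≢1+n i)) | ≡ᵇ-refl i = refl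
move-relPos (path-out i j)
  rewrite ≡ᵇ-refl i | ≢⇒≡ᵇ-false (n≢1+n j) | ≢⇒≡ᵇ-false (n≢2+n j) = refl
move-relPos (path-in i j)
  rewrite ≡ᵇ-refl i | ≢⇒≡ᵇ-false (≢-sym (n≢1+n j)) | ≡ᵇ-refl j = refl

module Tree (k : ℕ) where

  coords : Vertex (F k) → ℕ × ℕ
  coords x = decode (toℕ x)

  coords-valid : ∀ x → Valid k (coords x)
  coords-valid x with decode (toℕ x) | decode-spec (toℕ x)
  ... | i , j | j≤i , enc≡x = j≤i , enc-bound⇒≤ (subst (_< tri (suc k)) (sym enc≡x) (toℕ<n x))

  coords-injective : ∀ x y → coords x ≡ coords y → x ≡ y
  coords-injective x y e = toℕ-injective (begin
    toℕ x              ≡⟨ proj₂ (decode-spec (toℕ x)) ⟨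
    enc (coords x)     ≡⟨ cong enc e ⟩
    enc (coords y)     ≡⟨ proj₂ (decode-spec (toℕ y)) ⟩
    toℕ y              ∎)
    where open ≡-Reasoning

  vertexAt : ∀ p → Valid k p → Vertex (F k)
  vertexAt p v = fromℕ< (enc-bound p v)

  toℕ-vertexAt : ∀ p v → toℕ (vertexAt p v) ≡ enc p
  toℕ-vertexAt p v = toℕ-fromℕ< (enc-bound p v)

  coords-vertexAt : ∀ p v → coords (vertexAt p v) ≡ p
  coords-vertexAt (i , j) v = trans (cong decode (toℕ-vertexAt _ v)) (decode-enc i j (proj₁ v))

  edge⇒Adj : ∀ {x y} → Edge (F k) x y → Adj (coords x) (coords y)
  edge⇒Adj e = adjPair⇒Adj _ _ (Edge.joined e)

  Adj⇒edge : ∀ {x y} → Adj (coords x) (coords y) → Edge (F k) x y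
  Adj⇒edge a = edge (Adj⇒adjPair a)

  spine : ∀ r → r ≤ k → Vertex (F k)
  spine r r≤k = vertexAt (r , 0) (z≤n , r≤k)

  distance-to-spine : ∀ r (r≤k : r ≤ k) → DistanceFunction (F k) (spine r r≤k)
  distance-to-spine r r≤k = record
    { ψ         = height r ∘ coords
    ; ψ-root    = trans (cong (height r) (coords-vertexAt (r , 0) (z≤n , r≤k)))
                    (trans (+-identityʳ ∣ r - r ∣) (∣n-n∣≡0 r))
    ; ψ⁻¹-root  = λ {x} h≡0 → coords-injective x (spine r r≤k)
                    (trans (height-root r h≡0) (sym (coords-vertexAt (r , 0) (z≤n , r≤k))))
    ; lipschitz = height-lipschitz r ∘ edge⇒Adj
    ; descent   = descend
    }
    where
    descend : ∀ {x m} → height r (coords x) ≡ suc m →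
      ∃[ x' ] (Edge (F k) x x' × height r (coords x') ≡ m)
    descend {x} h with height-descent r≤k (coords x) (coords-valid x) h
    ... | q , adj , valid , h' =
      vertexAt q valid ,
      Adj⇒edge (subst (Adj (coords x)) (sym (coords-vertexAt q valid)) adj) ,
      trans (cong (height r) (coords-vertexAt q valid)) h'

  height-origin-bound : ∀ x → height 0 (coords x) ≤ 2 * k
  height-origin-bound x with coords x | coords-valid x
  ... | i , j | j≤i , i≤k = begin
    ∣ i - 0 ∣ + j  ≡⟨ cong (_+ j) (∣-∣-identityʳ i) ⟩
    i + j          ≤⟨ +-mono-≤ i≤k (≤-trans j≤i i≤k) ⟩
    k + k          ≡⟨ cong (k +_) (+-identityʳ k) ⟨
    2 * k          ∎
    where open ≤-Reasoning

  height-end-bound : ∀ x → height k (coords x) ≤ k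
  height-end-bound x with coords x | coords-valid x
  ... | i , j | j≤i , i≤k = begin
    ∣ i - k ∣ + j  ≡⟨ cong (_+ j) (m≤n⇒∣m-n∣≡n∸m i≤k) ⟩
    k ∸ i + j      ≤⟨ +-monoʳ-≤ (k ∸ i) j≤i ⟩
    k ∸ i + i      ≡⟨ m∸n+n≡m i≤k ⟩
    k              ∎
    where open ≤-Reasoning

  broadcast : Vertex (F k) → ℕ
  broadcast v = point (enc (0 , 0)) (2 * k) v + point (enc (k , 0)) k v

  broadcast-resolves : 1 ≤ k → IsResolvingBroadcast (F k) broadcast
  broadcast-resolves 1≤k = two-landmarks-resolve (F k)
    (distance-to-spine 0 z≤n) (distance-to-spine k ≤-refl) broadcast
    (≤-trans (≤-trans 1≤k (m≤m+n k _)) strength₀) (≤-trans 1≤k strengthₖ)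
    (λ x → ≤-trans (height-origin-bound x) strength₀)
    (λ x → ≤-trans (height-end-bound x) strengthₖ)
    (λ {x} {y} e₀ eₖ → coords-injective x y (heights-determine (coords-valid x) (coords-valid y) e₀ eₖ))
    where
    open ≤-Reasoning
    strength₀ : 2 * k ≤ broadcast (spine 0 z≤n)
    strength₀ = begin
      2 * k                                       ≡⟨ point-at _ _ _ (toℕ-vertexAt (0 , 0) (z≤n , z≤n)) ⟨
      point (enc (0 , 0)) (2 * k) (spine 0 z≤n)   ≤⟨ m≤m+n _ _ ⟩
      broadcast (spine 0 z≤n)                     ∎
    strengthₖ : k ≤ broadcast (spine k ≤-refl)
    strengthₖ = begin
      k                                           ≡⟨ point-at _ _ _ (toℕ-vertexAt (k , 0) (z≤n , ≤-refl)) ⟨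
      point (enc (k , 0)) k (spine k ≤-refl)      ≤⟨ m≤n+m _ _ ⟩
      broadcast (spine k ≤-refl)                  ∎

  bdim-upper : 1 ≤ k → BdimAtMost (F k) (3 * k)
  bdim-upper 1≤k = broadcast , broadcast-resolves 1≤k ,
    ≤-trans (cost-two-points (F k) _ _ (2 * k) k) (≤-reflexive (three k))
    where
    three : ∀ k → 2 * k + k ≡ 3 * k
    three = solve-∀

  neighbourhood-code : NeighbourhoodCode (F k) 5
  neighbourhood-code = record
    { label           = λ x z → relPos (coords x) (coords z)
    ; label<b         = λ x z → relPos<5 (coords x) (coords z)
    ; label-injective = λ {x} {y} {z} rx ry e → coords-injective x y
        (trans (sym (recover rx)) (trans (cong (λ c → move c (coords z)) e) (recover ry)))
    }
    where
    recover : ∀ {x z} → Reach (F k) 1 x z → move (relPos (coords x) (coords z)) (coords z) ≡ coords x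
    recover r with reach1⇒closed-neighbour (F k) r
    ... | inj₁ refl = move-relPos-self _
    ... | inj₂ e    = move-relPos (edge⇒Adj e)

twice-tri : ∀ m → 2 * tri m ≡ m * suc m
twice-tri zero    = refl
twice-tri (suc m) = begin
  2 * (tri m + suc m)        ≡⟨ *-distribˡ-+ 2 (tri m) (suc m) ⟩
  2 * tri m + 2 * suc m      ≡⟨ cong (_+ 2 * suc m) (twice-tri m) ⟩
  m * suc m + 2 * suc m      ≡⟨ step m ⟩
  suc m * suc (suc m)        ∎
  where
  open ≡-Reasoning
  step : ∀ m → m * suc m + 2 * suc m ≡ suc m * suc (suc m)
  step = solve-∀

order-lower : ∀ k → k * k ≤ 2 * order (F k)
order-lower k = begin
  k * k                ≤⟨ *-mono-≤ (n≤1+n k) (m≤n⇒m≤1+n (n≤1+n k)) ⟩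
  suc k * suc (suc k)  ≡⟨ twice-tri (suc k) ⟨
  2 * tri (suc k)      ∎
  where open ≤-Reasoning

order-upper : ∀ k → 1 ≤ k → order (F k) ≤ 3 * (k * k)
order-upper (suc m) _ = *-cancelˡ-≤ 2 (begin
  2 * tri (suc (suc m))                                ≡⟨ twice-tri (suc (suc m)) ⟩
  suc (suc m) * suc (suc (suc m))                      ≤⟨ m≤m+n _ (5 * m * m + 7 * m) ⟩
  suc (suc m) * suc (suc (suc m)) + (5 * m * m + 7 * m) ≡⟨ slack m ⟩
  2 * (3 * (suc m * suc m))                            ∎)
  where
  open ≤-Reasoning
  slack : ∀ m → suc (suc m) * suc (suc (suc m)) + (5 * m * m + 7 * m) ≡ 2 * (3 * (suc m * suc m))
  slack = solve-∀

-- n ≤ 1 + 5|A| and 2n = (k+1)(k+2) give k² ≤ 10|A|.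
adim-lower-F : ∀ k → AdimScaledAtLeast (F k) 10 (k * k)
adim-lower-F k A _ resolving = +-cancelʳ-≤ 2 (k * k) (10 * length A) (begin
  k * k + 2                  ≤⟨ m≤m+n _ (3 * k) ⟩
  k * k + 2 + 3 * k          ≡⟨ expand k ⟩
  suc k * suc (suc k)        ≡⟨ twice-tri (suc k) ⟨
  2 * tri (suc k)            ≤⟨ *-monoʳ-≤ 2 (adim-lower (F k) (Tree.neighbourhood-code k) A resolving) ⟩
  2 * suc (5 * length A)     ≡⟨ double (length A) ⟩
  10 * length A + 2          ∎)
  where
  open ≤-Reasoning
  expand : ∀ k → k * k + 2 + 3 * k ≡ suc k * suc (suc k)
  expand = solve-∀
  double : ∀ a → 2 * suc (5 * a) ≡ 10 * a + 2
  double = solve-∀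

adim-upper-F : ∀ k → 1 ≤ k → AdimAtMost (F k) (3 * (k * k))
adim-upper-F k 1≤k with adim-all-vertices (F k)
... | A , unique , resolving , |A|≤n = A , unique , resolving , ≤-trans |A|≤n (order-upper k 1≤k)

theorem4p8 :
    (∃[ c ] ∃[ C ] ∃[ k₀ ] ((k : ℕ) → k₀ ≤ k →
        (k * k ≤ c * order (F k)) × (order (F k) ≤ C * (k * k))))
    × (∃[ C ] ∃[ k₀ ] ((k : ℕ) → k₀ ≤ k → BdimAtMost (F k) (C * k)))
    × (∃[ c ] ∃[ C ] ∃[ k₀ ] ((k : ℕ) → k₀ ≤ k →
        AdimScaledAtLeast (F k) c (k * k) × AdimAtMost (F k) (C * (k * k))))
theorem4p8 =
  (2 , 3 , 1 , λ k 1≤k → order-lower k , order-upper k 1≤k) ,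
  (3 , 1 , λ k 1≤k → Tree.bdim-upper k 1≤k) ,
  (10 , 3 , 1 , λ k 1≤k → adim-lower-F k , adim-upper-F k 1≤k)
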